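{- For a non-negative integer $n$, let $[n]$ denote the sum of the $3$-adic digits of $n$. Let $r\geq1$ and let $x$ be an integer with $0\leq x<3^r$. Then $$\left[23x+\tfrac{3^r-1}{2}\right]\leq[x]+\left[2x+\tfrac{3^r-1}{2}\right]+2.$$ Moreover, if either $r=1$ and $x\neq1$, or $r=2$ and $x\neq3$, or $r\geq3$ and the first three $3$-adic digits of $x$ (after adding leading zeros so that $x$ has exactly $r$ digits) are neither $100$ nor $202$, then $$\left[23x+\tfrac{3^r-1}{2}\right]\leq[x]+\left[2x+\tfrac{3^r-1}{2}\right].$$ -}

module Defs where

open import Data.Nat using (ℕ; zero; suc; _+_; _/_; _%_)

-- sum of base-3 digits, computed with fuel (fuel ≥ n suffices since n/3 < n for n > 0)
digitSum3-fuel : ℕ → ℕ → ℕ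
digitSum3-fuel zero    n = 0
digitSum3-fuel (suc f) n = n % 3 + digitSum3-fuel f (n / 3)

digitSum3 : ℕ → ℕ
digitSum3 n = digitSum3-fuel n n

open import Data.Nat using (_∸_; _^_)
open import Data.Nat.Properties using (m^n≢0)

-- For x < 3^r written with exactly r base-3 digits (leading zeros added), r ≥ 3,
-- the number formed by its first three (most significant) digits: x / 3^(r-3).
-- Digits "100" correspond to value 9, digits "202" to value 20.
leading3Digits : (r x : ℕ) → ℕ
leading3Digits r x = _/_ x (3 ^ (r ∸ 3)) {{m^n≢0 3 (r ∸ 3)}}

{-# OPTIONS --safe #-}
module Submission where

-- Add 23x and 2x to the repunit c = (3^r − 1)/2 in base 3, from the least significant digit up.
-- Since every digit of c is 1, the state of the two additions is the pair of carries (t, b), with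
-- t < 24 and b < 3. A potential on these 72 states, satisfying a one-digit inequality that is
-- checked exhaustively, bounds the digit-sum excess [23x + c + t] − [x] − [2x + c + b] through
-- induction on the number of digits of x. At the initial state the potential vanishes; the slack 2
-- pays for the final carries in general, while for r ≥ 3 an exhaustive check of the three leading
-- digits shows that no slack is needed unless they are 100 or 202. The cases r ≤ 2 are checked directly.

open import Defs
open import Data.Nat using (ℕ; _+_; _*_; _∸_; _^_; _/_; _≤_; _<_; _≥_)
open import Data.Product using (_×_)
open import Data.Sum using (_⊎_)
open import Relation.Binary.PropositionalEquality using (_≡_; _≢_)

open import Data.Nat using (zero; suc; _%_; z≤n; s≤s; z<s; s≤s⁻¹; _≟_; _≤?_)
open import Data.Nat.Properties
open import Data.Nat.DivMod
open import Data.Nat.Tactic.RingSolver using (solve-∀)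
open import Data.List using (List; []; _∷_; head; drop)
open import Data.Maybe using (fromMaybe)
open import Data.Product using (_,_)
open import Data.Sum using (inj₁; inj₂)
open import Relation.Binary.PropositionalEquality
  using (refl; sym; trans; cong; cong₂; subst; subst₂; module ≡-Reasoning)
open import Relation.Nullary.Decidable using (Dec; from-yes; ¬?; _→-dec_)

digitSum3-fuel-zero : ∀ f → digitSum3-fuel f 0 ≡ 0
digitSum3-fuel-zero zero    = refl
digitSum3-fuel-zero (suc f) = digitSum3-fuel-zero f

n≤1+f⇒n/3≤f : ∀ {n} f → n ≤ suc f → n / 3 ≤ f
n≤1+f⇒n/3≤f {zero}  f _   = z≤n
n≤1+f⇒n/3≤f {suc n} f n≤ = s≤s⁻¹ (≤-trans (m/n<m (suc n) 3 (s≤s (s≤s z≤n))) n≤)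

digitSum3-fuel-irrelevant : ∀ {n} f g → n ≤ f → n ≤ g → digitSum3-fuel f n ≡ digitSum3-fuel g n
digitSum3-fuel-irrelevant zero    g       z≤n _   = sym (digitSum3-fuel-zero g)
digitSum3-fuel-irrelevant (suc f) zero    _   z≤n = digitSum3-fuel-zero (suc f)
digitSum3-fuel-irrelevant {n} (suc f) (suc g) n≤f n≤g =
  cong (n % 3 +_) (digitSum3-fuel-irrelevant f g (n≤1+f⇒n/3≤f f n≤f) (n≤1+f⇒n/3≤f g n≤g))

digitSum3-unfold : ∀ n → digitSum3 n ≡ n % 3 + digitSum3 (n / 3)
digitSum3-unfold zero    = refl
digitSum3-unfold (suc n) = cong (suc n % 3 +_)
  (digitSum3-fuel-irrelevant n (suc n / 3) (n≤1+f⇒n/3≤f n ≤-refl) ≤-refl)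

[r+q*3]/3≡q : ∀ {r} q → r < 3 → (r + q * 3) / 3 ≡ q
[r+q*3]/3≡q {r} q r<3 = begin
  (r + q * 3) / 3     ≡⟨ +-distrib-/ r (q * 3) remainders<3 ⟩
  r / 3 + q * 3 / 3   ≡⟨ cong₂ _+_ (m<n⇒m/n≡0 r<3) (m*n/n≡m q 3) ⟩
  q                   ∎
  where
  open ≡-Reasoning
  remainders<3 : r % 3 + q * 3 % 3 < 3
  remainders<3 = subst (_< 3)
    (sym (trans (cong₂ _+_ (m<n⇒m%n≡m r<3) (m*n%n≡0 q 3)) (+-identityʳ r))) r<3

digitSum3-digit : ∀ {r} q → r < 3 → digitSum3 (r + q * 3) ≡ r + digitSum3 q
digitSum3-digit {r} q r<3 = trans (digitSum3-unfold (r + q * 3))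
  (cong₂ _+_ (trans ([m+kn]%n≡m%n r q 3) (m<n⇒m%n≡m r<3)) (cong digitSum3 ([r+q*3]/3≡q q r<3)))

digitSum3-+*3 : ∀ n q → digitSum3 (n + q * 3) ≡ n % 3 + digitSum3 (q + n / 3)
digitSum3-+*3 n q = trans (cong digitSum3 regroup) (digitSum3-digit (q + n / 3) (m%n<n n 3))
  where
  regroup : n + q * 3 ≡ n % 3 + (q + n / 3) * 3
  regroup = begin
    n + q * 3                      ≡⟨ cong (_+ q * 3) (m≡m%n+[m/n]*n n 3) ⟩
    n % 3 + n / 3 * 3 + q * 3      ≡⟨ rearrange (n % 3) (n / 3) q ⟩
    n % 3 + (q + n / 3) * 3        ∎
    where
    open ≡-Reasoning
    rearrange : ∀ r p q → r + p * 3 + q * 3 ≡ r + (q + p) * 3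
    rearrange = solve-∀

repunit : ℕ → ℕ
repunit zero    = 0
repunit (suc m) = 1 + 3 * repunit m

3^m≡1+2*repunit : ∀ m → 3 ^ m ≡ 1 + 2 * repunit m
3^m≡1+2*repunit zero    = refl
3^m≡1+2*repunit (suc m) = trans (cong (3 *_) (3^m≡1+2*repunit m)) (expand (repunit m))
  where
  expand : ∀ u → 3 * (1 + 2 * u) ≡ 1 + 2 * (1 + 3 * u)
  expand = solve-∀

[3^m∸1]/2≡repunit : ∀ m → (3 ^ m ∸ 1) / 2 ≡ repunit m
[3^m∸1]/2≡repunit m rewrite 3^m≡1+2*repunit m | *-comm 2 (repunit m) = m*n/n≡m (repunit m) 2

column : ℕ → ℕ → ℕ → ℕ
column a d t = a * d + 1 + t

column-carry< : ∀ {a K t d} → a < K → t < K → d < 3 → column a d t / 3 < K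
column-carry< {a} {K} {t} {d} a<K t<K d<3 = m<n*o⇒m/o<n (begin-strict
  a * d + 1 + t   ≡⟨ +-assoc (a * d) 1 t ⟩
  a * d + suc t   ≤⟨ +-mono-≤ (*-monoʳ-≤ a (s≤s⁻¹ d<3)) t<K ⟩
  a * 2 + K       <⟨ +-monoˡ-< K (*-monoˡ-< 2 a<K) ⟩
  K * 2 + K       ≡⟨ triple K ⟩
  K * 3           ∎)
  where
  open ≤-Reasoning
  triple : ∀ k → k * 2 + k ≡ k * 3
  triple = solve-∀

digitSum3-*+repunit : ∀ a m x t → digitSum3 (a * x + repunit (suc m) + t)
  ≡ column a (x % 3) t % 3 + digitSum3 (a * (x / 3) + repunit m + column a (x % 3) t / 3)
digitSum3-*+repunit a m x t =
  trans (cong digitSum3 split) (digitSum3-+*3 (column a (x % 3) t) (a * (x / 3) + repunit m))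
  where
  split : a * x + repunit (suc m) + t ≡ column a (x % 3) t + (a * (x / 3) + repunit m) * 3
  split = begin
    a * x + repunit (suc m) + t
      ≡⟨ cong (λ y → a * y + repunit (suc m) + t) (m≡m%n+[m/n]*n x 3) ⟩
    a * (x % 3 + x / 3 * 3) + (1 + 3 * repunit m) + t
      ≡⟨ regroup a (x % 3) (x / 3) (repunit m) t ⟩
    column a (x % 3) t + (a * (x / 3) + repunit m) * 3 ∎
    where
    open ≡-Reasoning
    regroup : ∀ a d q u t → a * (d + q * 3) + (1 + 3 * u) + t ≡ (a * d + 1 + t) + (a * q + u) * 3
    regroup = solve-∀

row : ℕ → ℕ → ℕ → ℕ → ℕ
row p _ _ 0 = p
row _ q _ 1 = q
row _ _ r _ = r

-- potential t b + 2 is the largest value of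
-- digitSum3 (23 * x + repunit m + t) − digitSum3 x − digitSum3 (2 * x + repunit m + b)
-- over all m and x < 3 ^ m; equivalently, potential is the least function satisfying
-- potential-step and potentialBound-0.
potential : ℕ → ℕ → ℕ
potential t = fromMaybe (row 0 0 0) (head (drop t rows))
  where
  rows : List (ℕ → ℕ)
  rows =
      row 0 3 4
    ∷ row 1 2 5
    ∷ row 2 3 2
    ∷ row 1 4 3
    ∷ row 2 1 4
    ∷ row 3 2 3
    ∷ row 2 1 4
    ∷ row 3 2 5
    ∷ row 2 1 4
    ∷ row 1 2 5
    ∷ row 2 1 6
    ∷ row 3 2 1
    ∷ row 2 3 2
    ∷ row 3 2 3
    ∷ row 4 3 2
    ∷ row 3 2 3
    ∷ row 4 3 4
    ∷ row 3 2 1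
    ∷ row 2 3 2
    ∷ row 3 2 3
    ∷ row 4 3 2
    ∷ row 3 4 3
    ∷ row 4 3 4
    ∷ row 3 2 1
    ∷ []

potential-step : ∀ {t} → t < 24 → ∀ {b} → b < 3 → ∀ {d} → d < 3 →
  column 23 d t % 3 + potential (column 23 d t / 3) (column 2 d b / 3)
    ≤ d + column 2 d b % 3 + potential t b
potential-step = from-yes (allUpTo? (λ t → allUpTo? (λ b → allUpTo? (λ d →
  column 23 d t % 3 + potential (column 23 d t / 3) (column 2 d b / 3)
    ≤? d + column 2 d b % 3 + potential t b) 3) 3) 24)

DigitSumBound : ℕ → ℕ → ℕ → ℕ → ℕ → Set
DigitSumBound m x t b s =
  digitSum3 (23 * x + repunit m + t) ≤ digitSum3 x + digitSum3 (2 * x + repunit m + b) + s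

PotentialBound : ℕ → ℕ → ℕ → Set
PotentialBound s m x = ∀ {t} → t < 24 → ∀ {b} → b < 3 → DigitSumBound m x t b (potential t b + s)

digitSumBound? : ∀ m x t b s → Dec (DigitSumBound m x t b s)
digitSumBound? m x t b s = _ ≤? _

potentialBound? : ∀ s m x → Dec (PotentialBound s m x)
potentialBound? s m x = allUpTo? (λ t → allUpTo? (λ b → digitSumBound? m x t b (potential t b + s)) 3) 24

potentialBound-step : ∀ {s m} x → PotentialBound s m (x / 3) → PotentialBound s (suc m) x
potentialBound-step {s} {m} x bound {t} t<24 {b} b<3 = begin
  digitSum3 (23 * x + repunit (suc m) + t)
    ≡⟨ digitSum3-*+repunit 23 m x t ⟩
  T % 3 + digitSum3 (23 * x′ + repunit m + T / 3)
    ≤⟨ +-monoʳ-≤ (T % 3) (bound T/3<24 B/3<3) ⟩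
  T % 3 + (digitSum3 x′ + S′ + (potential (T / 3) (B / 3) + s))
    ≡⟨ shuffle (T % 3) (digitSum3 x′) S′ (potential (T / 3) (B / 3)) s ⟩
  digitSum3 x′ + S′ + (T % 3 + potential (T / 3) (B / 3)) + s
    ≤⟨ +-monoˡ-≤ s (+-monoʳ-≤ (digitSum3 x′ + S′) (potential-step t<24 b<3 d<3)) ⟩
  digitSum3 x′ + S′ + (d + B % 3 + potential t b) + s
    ≡⟨ unshuffle (digitSum3 x′) S′ d (B % 3) (potential t b) s ⟩
  (d + digitSum3 x′) + (B % 3 + S′) + (potential t b + s)
    ≡⟨ sym (cong₂ (λ u w → u + w + (potential t b + s)) (digitSum3-unfold x) (digitSum3-*+repunit 2 m x b)) ⟩
  digitSum3 x + digitSum3 (2 * x + repunit (suc m) + b) + (potential t b + s) ∎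
  where
  open ≤-Reasoning
  d = x % 3
  x′ = x / 3
  T = column 23 d t
  B = column 2 d b
  S′ = digitSum3 (2 * x′ + repunit m + B / 3)
  d<3 : d < 3
  d<3 = m%n<n x 3
  T/3<24 : T / 3 < 24
  T/3<24 = column-carry< (s≤s ≤-refl) t<24 d<3
  B/3<3 : B / 3 < 3
  B/3<3 = column-carry< (s≤s ≤-refl) b<3 d<3
  shuffle : ∀ r u v p s → r + (u + v + (p + s)) ≡ u + v + (r + p) + s
  shuffle = solve-∀
  unshuffle : ∀ u v d r p s → u + v + (d + r + p) + s ≡ (d + u) + (r + v) + (p + s)
  unshuffle = solve-∀

dropDigits : ℕ → ℕ → ℕ
dropDigits k x = _/_ x (3 ^ k) {{m^n≢0 3 k}}

dropDigits-suc : ∀ k x → dropDigits k (x / 3) ≡ dropDigits (suc k) x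
dropDigits-suc k x = m/n/o≡m/[n*o] x 3 (3 ^ k) {{_}} {{m^n≢0 3 k}} {{m^n≢0 3 (suc k)}}

potentialBound-lift : ∀ k {s m} x → PotentialBound s m (dropDigits k x) → PotentialBound s (k + m) x
potentialBound-lift zero    {s} {m} x bound = subst (PotentialBound s m) (n/1≡n x) bound
potentialBound-lift (suc k) {s} {m} x bound = potentialBound-step {m = k + m} x
  (potentialBound-lift k {m = m} (x / 3) (subst (PotentialBound s m) (sym (dropDigits-suc k x)) bound))

potentialBound-0 : PotentialBound 2 0 0
potentialBound-0 = from-yes (potentialBound? 2 0 0)

potentialBound-3 : ∀ {y} → y < 27 → y ≢ 9 → y ≢ 20 → PotentialBound 0 3 y
potentialBound-3 = from-yes (allUpTo? (λ y →
  ¬? (y ≟ 9) →-dec ¬? (y ≟ 20) →-dec potentialBound? 0 3 y) 27)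

digitSumBound-1 : ∀ {x} → x < 3 → x ≢ 1 → DigitSumBound 1 x 0 0 0
digitSumBound-1 = from-yes (allUpTo? (λ x → ¬? (x ≟ 1) →-dec digitSumBound? 1 x 0 0 0) 3)

digitSumBound-2 : ∀ {x} → x < 9 → x ≢ 3 → DigitSumBound 2 x 0 0 0
digitSumBound-2 = from-yes (allUpTo? (λ x → ¬? (x ≟ 3) →-dec digitSumBound? 2 x 0 0 0) 9)

potentialBound : ∀ r x → x < 3 ^ r → PotentialBound 2 r x
potentialBound r x x<3^r = subst (λ m → PotentialBound 2 m x) (+-identityʳ r)
  (potentialBound-lift r x (subst (PotentialBound 2 0) (sym x/3^r≡0) potentialBound-0))
  where
  x/3^r≡0 : dropDigits r x ≡ 0
  x/3^r≡0 = m<n⇒m/n≡0 {{m^n≢0 3 r}} x<3^r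

potentialBound-nonexceptional : ∀ r x → r ≥ 3 → x < 3 ^ r →
  leading3Digits r x ≢ 9 → leading3Digits r x ≢ 20 → PotentialBound 0 r x
potentialBound-nonexceptional r x r≥3 x<3^r ≢9 ≢20 =
  subst (λ m → PotentialBound 0 m x) (m∸n+n≡m r≥3)
  (potentialBound-lift (r ∸ 3) x (potentialBound-3 leading<27 ≢9 ≢20))
  where
  leading<27 : leading3Digits r x < 27
  leading<27 = m<n*o⇒m/o<n {{m^n≢0 3 (r ∸ 3)}} (subst (x <_) 3^r≡27*3^[r∸3] x<3^r)
    where
    3^r≡27*3^[r∸3] : 3 ^ r ≡ 27 * 3 ^ (r ∸ 3)
    3^r≡27*3^[r∸3] = trans (cong (3 ^_) (sym (m+[n∸m]≡n r≥3))) (^-distribˡ-+-* 3 3 (r ∸ 3))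

digitSumBound⇒ : ∀ m x {s} → DigitSumBound m x 0 0 s →
  digitSum3 (23 * x + (3 ^ m ∸ 1) / 2) ≤ digitSum3 x + digitSum3 (2 * x + (3 ^ m ∸ 1) / 2) + s
digitSumBound⇒ m x {s} =
  subst₂ (λ u w → digitSum3 u ≤ digitSum3 x + digitSum3 w + s) (repunit-form 23) (repunit-form 2)
  where
  repunit-form : ∀ a → a * x + repunit m + 0 ≡ a * x + (3 ^ m ∸ 1) / 2
  repunit-form a = trans (+-identityʳ _) (cong (a * x +_) (sym ([3^m∸1]/2≡repunit m)))

lemma3p3 : (r x : ℕ) → 1 ≤ r → x < 3 ^ r →
    (digitSum3 (23 * x + (3 ^ r ∸ 1) / 2) ≤ digitSum3 x + digitSum3 (2 * x + (3 ^ r ∸ 1) / 2) + 2)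
    × (((r ≡ 1 × x ≢ 1) ⊎ (r ≡ 2 × x ≢ 3) ⊎ (r ≥ 3 × leading3Digits r x ≢ 9 × leading3Digits r x ≢ 20)) →
       digitSum3 (23 * x + (3 ^ r ∸ 1) / 2) ≤ digitSum3 x + digitSum3 (2 * x + (3 ^ r ∸ 1) / 2))
lemma3p3 r x _ x<3^r = digitSumBound⇒ r x (potentialBound r x x<3^r z<s z<s) , λ where
    (inj₁ (refl , x≢1))            → sharp (digitSumBound-1 x<3^r x≢1)
    (inj₂ (inj₁ (refl , x≢3)))     → sharp (digitSumBound-2 x<3^r x≢3)
    (inj₂ (inj₂ (r≥3 , ≢9 , ≢20))) → sharp (potentialBound-nonexceptional r x r≥3 x<3^r ≢9 ≢20 z<s z<s)
  where
  sharp : DigitSumBound r x 0 0 0 →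
    digitSum3 (23 * x + (3 ^ r ∸ 1) / 2) ≤ digitSum3 x + digitSum3 (2 * x + (3 ^ r ∸ 1) / 2)
  sharp bound = ≤-trans (digitSumBound⇒ r x bound) (≤-reflexive (+-identityʳ _))
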